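{- Let $n\ge1$ and work in $\mathbb{Q}[x_{ij}: i\in[n+1], j\in[n]]$. For $D\subseteq[n+1]$ let $B_D:=\sum_{\gamma\colon D\hookrightarrow[n]}\prod_{i\in D}x_{i\gamma(i)}$ (sum over injective maps $\gamma$ from $D$ to $[n]$; in particular $B_\emptyset=1$), and for $D\subseteq[n+1]$ and $j\in[n]$ let $X_{D\mapsto j}:=\prod_{i\in D}x_{ij}$. Then for every $D\subseteq[n+1]$ with $|D|\ge2$, $$B_D=\sum_{k=1}^{|D|}(-1)^{k-1}\frac{k!}{|D|}\sum_{\substack{D_k\subseteq D\\|D_k|=k}}\Big(\sum_{j\in[n]}X_{D_k\mapsto j}\Big)\cdot B_{D\setminus D_k}.$$ -}

module Defs where

open import Data.Nat using (ℕ; zero; suc; _∸_)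
open import Data.Nat using (_!)
open import Data.Fin using (Fin)
open import Data.Fin.Properties using (_≟_)
open import Data.Fin.Subset using (Subset; inside; outside; ∣_∣; _─_)
open import Data.Fin.Subset.Properties using (_∈?_; _⊆?_)
open import Data.List using (List; []; _∷_; map; filter; foldr; zipWith; concatMap; allFin; upTo; length)
open import Data.Vec using (Vec; []; _∷_)
open import Data.Integer using (+_)
open import Data.Rational using (ℚ; 0ℚ; 1ℚ; _+_; _*_; -_; _/_)
open import Data.Product using (_×_; _,_)
open import Relation.Nullary.Decidable using (_×-dec_)
open import Data.Nat.Properties using () renaming (_≟_ to _≟ℕ_)
import Data.List.Relation.Unary.Unique.DecPropositional as UniqueDec

Σℚ : List ℚ → ℚ
Σℚ = foldr _+_ 0ℚ

Πℚ : List ℚ → ℚ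
Πℚ = foldr _*_ 1ℚ

powℚ : ℚ → ℕ → ℚ
powℚ q zero    = 1ℚ
powℚ q (suc m) = q * powℚ q m

elems : ∀ {m} → Subset m → List (Fin m)
elems {m} D = filter (_∈? D) (allFin m)

tuples : (n k : ℕ) → List (List (Fin n))
tuples n zero    = [] ∷ []
tuples n (suc k) = concatMap (λ j → map (j ∷_) (tuples n k)) (allFin n)

allSubsets : (m : ℕ) → List (Subset m)
allSubsets zero    = [] ∷ []
allSubsets (suc m) = concatMap (λ S → (inside ∷ S) ∷ (outside ∷ S) ∷ []) (allSubsets m)

-- Injective maps γ : D ↪ [n], represented as the list of values
-- (γ(i₁), …, γ(iₖ)) on the increasing enumeration i₁ < … < iₖ of D,
-- with pairwise distinct entries.
injections : ∀ {m} (n : ℕ) → Subset m → List (List (Fin n))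
injections n D = filter (UniqueDec.unique? _≟_) (tuples n (length (elems D)))

-- Variables: x i j, i ∈ [n+1], j ∈ [n] (evaluated at rational values).
Vars : ℕ → Set
Vars n = Fin (suc n) → Fin n → ℚ

B : ∀ {n} → Vars n → Subset (suc n) → ℚ
B {n} x D = Σℚ (map (λ γ → Πℚ (zipWith x (elems D) γ)) (injections n D))

X : ∀ {n} → Vars n → Subset (suc n) → Fin n → ℚ
X x D j = Πℚ (map (λ i → x i j) (elems D))

subsetsOfSize : ∀ {m} → Subset m → ℕ → List (Subset m)
subsetsOfSize {m} D k = filter (λ S → (S ⊆? D) ×-dec (∣ S ∣ ≟ℕ k)) (allSubsets m)

-- k! / d as a rational (only used with d = |D| ≥ 2; value at d = 0 irrelevant).
fracℚ : ℕ → ℕ → ℚ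
fracℚ a zero    = 0ℚ
fracℚ a (suc d) = (+ a) / suc d

RHS : ∀ {n} → Vars n → Subset (suc n) → ℚ
RHS {n} x D =
  Σℚ (map (λ k →
        powℚ (- 1ℚ) (k ∸ 1) * fracℚ (k !) ∣ D ∣
        * Σℚ (map (λ Dk → Σℚ (map (X x Dk) (allFin n)) * B x (D ─ Dk))
                  (subsetsOfSize D k)))
      (map suc (upTo ∣ D ∣)))

{-# OPTIONS --safe #-}
-- Multiply the identity by |D| and expand both sides over all maps f : D → [n] (not only injective
-- ones), f contributing the monomial Π_{i ∈ D} x_{i f(i)}.  Encoding D_k ⊆ D as a mask on D,
-- X_{D_k ↦ j} · B_{D ∖ D_k} collects the monomials of the maps that are constant j on D_k and
-- injective off D_k.  Hence the coefficient of f on the right is Σ_j Σ_S (-1)^{|S|-1} |S|!, over the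
-- nonempty S ⊆ f⁻¹(j) off which f is injective.  If f is injective off f⁻¹(j) and c = |f⁻¹(j)| ≥ 1,
-- these S are f⁻¹(j) and its c subsets of size c - 1, which gives (-1)^{c-1} c! + c (-1)^{c-2} (c-1)!:
-- this is 1 for c = 1 and 0 for c ≥ 2.  Summing over j leaves |D| if f is injective and 0 otherwise,
-- that is, |D| · B_D.
module Submission where

open import Defs
open import Data.Bool using (true; false; if_then_else_)
open import Data.Nat as ℕ using (ℕ; zero; suc; _∸_; _!)
import Data.Nat.Properties as ℕ
import Data.Integer as ℤ
import Data.Integer.Properties as ℤ
open import Data.Integer.Tactic.RingSolver using () renaming (solve-∀ to ℤ-solve-∀)
open import Data.Rational using (ℚ; 0ℚ; 1ℚ; _+_; _*_; -_; _/_; fromℚᵘ)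
open import Data.Rational.Properties as ℚ
  using (+-*-commutativeRing; fromℚᵘ-cong; fromℚᵘ-toℚᵘ; toℚᵘ-fromℚᵘ; toℚᵘ-homo-+; toℚᵘ-homo-*)
open import Data.Rational.Unnormalised as ℚᵘ using (ℚᵘ; mkℚᵘ; *≡*)
import Data.Rational.Unnormalised.Properties as ℚᵘ
open import Data.List
  using (List; []; _∷_; _++_; _∷ʳ_; map; filter; concatMap; allFin; length; zipWith; upTo)
open import Data.List.Properties
  using (map-++; map-∘; map-tabulate; length-map; filter-all; filter-none; ∷ʳ-++)
open import Data.List.Membership.Propositional.Properties
  using (∈-filter⁺; ∈-filter⁻; ∈-++⁺ˡ; ∈-++⁺ʳ; ∈-++⁻; ∈-allFin; ∈-map⁺; ∈-upTo⁺)
open import Data.List.Relation.Unary.All using (All; []; _∷_; all?; universal)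
open import Data.List.Relation.Unary.All.Properties using (All¬⇒¬Any; ¬Any⇒All¬)
open import Data.List.Relation.Unary.AllPairs using ([]; _∷_)
open import Data.List.Relation.Unary.Any using (here)
open import Data.List.Relation.Unary.Unique.Propositional using (Unique)
open import Data.List.Relation.Unary.Unique.Propositional.Properties using (filter⁺; allFin⁺; map⁺; upTo⁺)
open import Data.Fin as Fin using (Fin; zero; suc)
open import Data.Fin.Properties using (_≟_)
open import Data.Fin.Subset using (Subset; ∣_∣; _─_; ∁)
open import Data.Fin.Subset.Properties using (_⊆?_; ∣p∣≤n)
import Data.Fin.Subset.Properties as Subset
open import Data.Vec using ([]; _∷_)
open import Data.Product using (_×_; _,_; proj₁; proj₂)
open import Data.Sum using (inj₁; inj₂)
open import Function using (_∘_; mk⇔)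
open import Relation.Binary.Definitions using (DecidableEquality)
open import Relation.Binary.PropositionalEquality
open import Relation.Binary.PropositionalEquality.Properties using (setoid)
open import Relation.Nullary using (Dec; yes; no; does; ¬_; ¬?; contradiction)
open import Relation.Nullary.Decidable using (_×-dec_; dec⇒maybe; does-⇔)
open import Relation.Unary using (Pred; Decidable)
open import Tactic.RingSolver using (solve-∀)
open import Tactic.RingSolver.Core.AlmostCommutativeRing using (AlmostCommutativeRing; fromCommutativeRing)

ℚ-ring : AlmostCommutativeRing _ _
ℚ-ring = fromCommutativeRing +-*-commutativeRing (λ q → dec⇒maybe (0ℚ ℚ.≟ q))

𝟙 : ∀ {p} {P : Set p} → Dec P → ℚ
𝟙 P? = if does P? then 1ℚ else 0ℚ

module _ {p} {P : Set p} where

  𝟙-yes : P → (P? : Dec P) → 𝟙 P? ≡ 1ℚ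
  𝟙-yes p (yes _) = refl
  𝟙-yes p (no ¬p) = contradiction p ¬p

  𝟙-no : ¬ P → (P? : Dec P) → 𝟙 P? ≡ 0ℚ
  𝟙-no ¬p (yes p) = contradiction p ¬p
  𝟙-no ¬p (no _)  = refl

  module _ {q} {Q : Set q} where

    𝟙-× : (P? : Dec P) (Q? : Dec Q) → 𝟙 (P? ×-dec Q?) ≡ 𝟙 P? * 𝟙 Q?
    𝟙-× (yes _) Q? = sym (ℚ.*-identityˡ (𝟙 Q?))
    𝟙-× (no _)  Q? = sym (ℚ.*-zeroˡ (𝟙 Q?))

    𝟙-⇔ : (P → Q) → (Q → P) → (P? : Dec P) (Q? : Dec Q) → 𝟙 P? ≡ 𝟙 Q?
    𝟙-⇔ to from P? Q? = cong (if_then 1ℚ else 0ℚ) (does-⇔ (mk⇔ to from) P? Q?)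

private
  variable
    A A′ A″ : Set

Σ-++ : (xs ys : List ℚ) → Σℚ (xs ++ ys) ≡ Σℚ xs + Σℚ ys
Σ-++ []       ys = sym (ℚ.+-identityˡ (Σℚ ys))
Σ-++ (x ∷ xs) ys = trans (cong (x +_) (Σ-++ xs ys)) (sym (ℚ.+-assoc x (Σℚ xs) (Σℚ ys)))

Σ-cong : {f g : A → ℚ} → (∀ a → f a ≡ g a) → ∀ l → Σℚ (map f l) ≡ Σℚ (map g l)
Σ-cong f≗g []      = refl
Σ-cong f≗g (a ∷ l) = cong₂ _+_ (f≗g a) (Σ-cong f≗g l)

Σ-≡0 : {f : A → ℚ} → (∀ a → f a ≡ 0ℚ) → ∀ l → Σℚ (map f l) ≡ 0ℚ
Σ-≡0 f≗0 []      = refl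
Σ-≡0 f≗0 (a ∷ l) = trans (cong₂ _+_ (f≗0 a) (Σ-≡0 f≗0 l)) (ℚ.+-identityˡ 0ℚ)

Σ-+ : (f g : A → ℚ) → ∀ l → Σℚ (map (λ a → f a + g a) l) ≡ Σℚ (map f l) + Σℚ (map g l)
Σ-+ f g []      = sym (ℚ.+-identityˡ 0ℚ)
Σ-+ f g (a ∷ l) = trans (cong (f a + g a +_) (Σ-+ f g l)) (+-interchange (f a) (g a) _ _)
  where
  +-interchange : ∀ w x y z → (w + x) + (y + z) ≡ (w + y) + (x + z)
  +-interchange = solve-∀ ℚ-ring

Σ-*ˡ : (c : ℚ) (f : A → ℚ) → ∀ l → Σℚ (map (λ a → c * f a) l) ≡ c * Σℚ (map f l)
Σ-*ˡ c f []      = sym (ℚ.*-zeroʳ c)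
Σ-*ˡ c f (a ∷ l) = trans (cong (c * f a +_) (Σ-*ˡ c f l)) (sym (ℚ.*-distribˡ-+ c (f a) _))

Σ-*ʳ : (c : ℚ) (f : A → ℚ) → ∀ l → Σℚ (map (λ a → f a * c) l) ≡ Σℚ (map f l) * c
Σ-*ʳ c f l = trans (Σ-cong (λ a → ℚ.*-comm (f a) c) l) (trans (Σ-*ˡ c f l) (ℚ.*-comm c _))

Σ-filter : ∀ {p} {P : Pred A p} (P? : Decidable P) (f : A → ℚ) → ∀ l →
           Σℚ (map f (filter P? l)) ≡ Σℚ (map (λ a → 𝟙 (P? a) * f a) l)
Σ-filter P? f []      = refl
Σ-filter P? f (a ∷ l) with does (P? a)
... | true  = cong₂ _+_ (sym (ℚ.*-identityˡ (f a))) (Σ-filter P? f l)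
... | false = trans (Σ-filter P? f l)
                (sym (trans (cong (_+ _) (ℚ.*-zeroˡ (f a))) (ℚ.+-identityˡ _)))

Σ-concatMap : (f : A′ → ℚ) (g : A → List A′) → ∀ l →
              Σℚ (map f (concatMap g l)) ≡ Σℚ (map (λ a → Σℚ (map f (g a))) l)
Σ-concatMap f g []      = refl
Σ-concatMap f g (a ∷ l) = begin
  Σℚ (map f (g a ++ concatMap g l))             ≡⟨ cong Σℚ (map-++ f (g a) _) ⟩
  Σℚ (map f (g a) ++ map f (concatMap g l))     ≡⟨ Σ-++ (map f (g a)) _ ⟩
  Σℚ (map f (g a)) + Σℚ (map f (concatMap g l)) ≡⟨ cong (Σℚ (map f (g a)) +_) (Σ-concatMap f g l) ⟩
  Σℚ (map f (g a)) + Σℚ (map (λ a → Σℚ (map f (g a))) l) ∎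
  where open ≡-Reasoning

Σ-swap : (h : A → A′ → ℚ) → ∀ as bs →
         Σℚ (map (λ a → Σℚ (map (h a) bs)) as) ≡ Σℚ (map (λ b → Σℚ (map (λ a → h a b) as)) bs)
Σ-swap h []       bs = sym (Σ-≡0 (λ _ → refl) bs)
Σ-swap h (a ∷ as) bs =
  trans (cong (Σℚ (map (h a) bs) +_) (Σ-swap h as bs)) (sym (Σ-+ (h a) _ bs))

Σ-reverse₃ : (F : A → A′ → A″ → ℚ) → ∀ as bs cs →
             Σℚ (map (λ a → Σℚ (map (λ b → Σℚ (map (F a b) cs)) bs)) as)
               ≡ Σℚ (map (λ c → Σℚ (map (λ b → Σℚ (map (λ a → F a b c) as)) bs)) cs)
Σ-reverse₃ F as bs cs = trans (Σ-cong (λ a → Σ-swap (F a) bs cs) as)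
  (trans (Σ-swap (λ a c → Σℚ (map (λ b → F a b c) bs)) as cs)
         (Σ-cong (λ c → Σ-swap (λ a b → F a b c) as bs) cs))

fromℚᵘ-homo-+ : ∀ p q → fromℚᵘ (p ℚᵘ.+ q) ≡ fromℚᵘ p + fromℚᵘ q
fromℚᵘ-homo-+ p q = trans (fromℚᵘ-cong (ℚᵘ.≃-sym (ℚᵘ.≃-trans (toℚᵘ-homo-+ (fromℚᵘ p) (fromℚᵘ q))
  (ℚᵘ.+-cong (toℚᵘ-fromℚᵘ p) (toℚᵘ-fromℚᵘ q))))) (fromℚᵘ-toℚᵘ _)

fromℚᵘ-homo-* : ∀ p q → fromℚᵘ (p ℚᵘ.* q) ≡ fromℚᵘ p * fromℚᵘ q
fromℚᵘ-homo-* p q = trans (fromℚᵘ-cong (ℚᵘ.≃-sym (ℚᵘ.≃-trans (toℚᵘ-homo-* (fromℚᵘ p) (fromℚᵘ q))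
  (ℚᵘ.*-cong (toℚᵘ-fromℚᵘ p) (toℚᵘ-fromℚᵘ q))))) (fromℚᵘ-toℚᵘ _)

ιᵘ : ℕ → ℚᵘ
ιᵘ k = mkℚᵘ (ℤ.+ k) 0

ι : ℕ → ℚ
ι k = fromℚᵘ (ιᵘ k)

ι-suc : ∀ k → ι (suc k) ≡ 1ℚ + ι k
ι-suc k = trans (fromℚᵘ-cong {ιᵘ (suc k)} {ιᵘ 1 ℚᵘ.+ ιᵘ k} (*≡* (identity (ℤ.+ k))))
                (fromℚᵘ-homo-+ (ιᵘ 1) (ιᵘ k))
  where
  identity : ∀ k → (ℤ.1ℤ ℤ.+ k) ℤ.* (ℤ.1ℤ ℤ.* ℤ.1ℤ)
                   ≡ (ℤ.1ℤ ℤ.* ℤ.1ℤ ℤ.+ k ℤ.* ℤ.1ℤ) ℤ.* ℤ.1ℤ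
  identity = ℤ-solve-∀

ι-* : ∀ m k → ι (m ℕ.* k) ≡ ι m * ι k
ι-* m k = trans (fromℚᵘ-cong {ιᵘ (m ℕ.* k)} {ιᵘ m ℚᵘ.* ιᵘ k} (*≡* (cong (ℤ._* ℤ.1ℤ) (ℤ.pos-* m k))))
                (fromℚᵘ-homo-* (ιᵘ m) (ιᵘ k))

fracℚ-as-* : ∀ a {d} → 1 ℕ.≤ d → fracℚ a d ≡ ι a * fracℚ 1 d
fracℚ-as-* a {suc d} _ =
  trans (fromℚᵘ-cong {mkℚᵘ (ℤ.+ a) d} {ιᵘ a ℚᵘ.* mkℚᵘ (ℤ.+ 1) d} (*≡* (identity (ℤ.+ a) (ℤ.+ suc d))))
        (fromℚᵘ-homo-* (ιᵘ a) (mkℚᵘ (ℤ.+ 1) d))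
  where
  identity : ∀ a d → a ℤ.* (ℤ.1ℤ ℤ.* d) ≡ (a ℤ.* ℤ.1ℤ) ℤ.* d
  identity = ℤ-solve-∀

fracℚ-1-*-ι : ∀ {d} → 1 ℕ.≤ d → fracℚ 1 d * ι d ≡ 1ℚ
fracℚ-1-*-ι {suc d} _ =
  trans (sym (fromℚᵘ-homo-* (mkℚᵘ (ℤ.+ 1) d) (ιᵘ (suc d))))
        (fromℚᵘ-cong {mkℚᵘ (ℤ.+ 1) d ℚᵘ.* ιᵘ (suc d)} {ιᵘ 1} (*≡* (identity (ℤ.+ suc d))))
  where
  identity : ∀ d → (ℤ.1ℤ ℤ.* d) ℤ.* ℤ.1ℤ ≡ ℤ.1ℤ ℤ.* (d ℤ.* ℤ.1ℤ)
  identity = ℤ-solve-∀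

-- signed! 0 = 0 discards the empty mask, matching k ≥ 1 in the statement.
signed! : ℕ → ℚ
signed! zero    = 0ℚ
signed! (suc k) = powℚ (- 1ℚ) k * ι (suc k !)

-- Φ w c sums w ∣S∣ over the subsets S of a c-element set that miss at most one element.
Φ : (ℕ → ℚ) → ℕ → ℚ
Φ w zero    = w zero
Φ w (suc c) = w (suc c) + ι (suc c) * w c

Φ-suc : ∀ w c → Φ (w ∘ suc) c + w c ≡ Φ w (suc c)
Φ-suc w zero    = cong (w 1 +_) (sym (ℚ.*-identityˡ (w 0)))
Φ-suc w (suc c) = trans (identity (w (suc (suc c))) (ι (suc c)) (w (suc c)))
                        (cong (λ i → w (suc (suc c)) + i * w (suc c)) (sym (ι-suc (suc c))))
  where
  identity : ∀ u i v → (u + i * v) + v ≡ u + (1ℚ + i) * v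
  identity = solve-∀ ℚ-ring

Φ-signed!-≤1 : ∀ {c} → c ℕ.≤ 1 → Φ signed! c ≡ ι c
Φ-signed!-≤1 ℕ.z≤n         = refl
Φ-signed!-≤1 (ℕ.s≤s ℕ.z≤n) = refl

Φ-signed!-2+ : ∀ c → Φ signed! (suc (suc c)) ≡ 0ℚ
Φ-signed!-2+ c =
  trans (cong (λ i → powℚ (- 1ℚ) (suc c) * i + ι (suc (suc c)) * signed! (suc c)) (ι-* (suc (suc c)) (suc c !)))
        (identity (powℚ (- 1ℚ) c) (ι (suc (suc c))) (ι (suc c !)))
  where
  identity : ∀ s n f → (- 1ℚ * s) * (n * f) + n * (s * f) ≡ 0ℚ
  identity = solve-∀ ℚ-ring

select : ∀ {k} → Subset k → List A → List A
select []          _       = []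
select (_ ∷ _)     []      = []
select (true ∷ T)  (a ∷ l) = a ∷ select T l
select (false ∷ T) (a ∷ l) = select T l

select-map : (f : A → A′) → ∀ {k} (T : Subset k) l → select T (map f l) ≡ map f (select T l)
select-map f []          l       = refl
select-map f (_ ∷ _)     []      = refl
select-map f (true ∷ T)  (a ∷ l) = cong (f a ∷_) (select-map f T l)
select-map f (false ∷ T) (a ∷ l) = select-map f T l

Σ-allSubsets-suc : ∀ {m} (g : Subset (suc m) → ℚ) →
                   Σℚ (map g (allSubsets (suc m))) ≡ Σℚ (map (λ T → g (true ∷ T) + g (false ∷ T)) (allSubsets m))
Σ-allSubsets-suc {m} g = trans (Σ-concatMap g (λ T → (true ∷ T) ∷ (false ∷ T) ∷ []) (allSubsets m))
  (Σ-cong (λ T → cong (g (true ∷ T) +_) (ℚ.+-identityʳ (g (false ∷ T)))) (allSubsets m))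

-- The subsets of D are the embeddings of the masks on the increasing enumeration elems D of D.
embed : ∀ {m} (D : Subset m) → Subset ∣ D ∣ → Subset m
embed []          []      = []
embed (true ∷ D)  (b ∷ T) = b ∷ embed D T
embed (false ∷ D) T       = false ∷ embed D T

Σ-⊆-embed : ∀ {m} (D : Subset m) (G : Subset m → ℚ) →
            Σℚ (map (λ S → 𝟙 (S ⊆? D) * G S) (allSubsets m)) ≡ Σℚ (map (G ∘ embed D) (allSubsets ∣ D ∣))
Σ-⊆-embed []          G = cong (_+ 0ℚ) (ℚ.*-identityˡ (G []))
Σ-⊆-embed {suc m} (true ∷ D) G = begin
  Σℚ (map (λ S → 𝟙 (S ⊆? true ∷ D) * G S) (allSubsets (suc m)))
    ≡⟨ Σ-allSubsets-suc {m} _ ⟩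
  Σℚ (map (λ S → 𝟙 (S ⊆? D) * G (true ∷ S) + 𝟙 (S ⊆? D) * G (false ∷ S)) (allSubsets m))
    ≡⟨ Σ-cong (λ S → sym (ℚ.*-distribˡ-+ (𝟙 (S ⊆? D)) _ _)) (allSubsets m) ⟩
  Σℚ (map (λ S → 𝟙 (S ⊆? D) * (G (true ∷ S) + G (false ∷ S))) (allSubsets m))
    ≡⟨ Σ-⊆-embed D (λ S → G (true ∷ S) + G (false ∷ S)) ⟩
  Σℚ (map (λ T → G (true ∷ embed D T) + G (false ∷ embed D T)) (allSubsets ∣ D ∣))
    ≡⟨ Σ-allSubsets-suc (G ∘ embed (true ∷ D)) ⟨
  Σℚ (map (G ∘ embed (true ∷ D)) (allSubsets (suc ∣ D ∣))) ∎
  where open ≡-Reasoning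
Σ-⊆-embed {suc m} (false ∷ D) G = begin
  Σℚ (map (λ S → 𝟙 (S ⊆? false ∷ D) * G S) (allSubsets (suc m)))
    ≡⟨ Σ-allSubsets-suc {m} _ ⟩
  Σℚ (map (λ S → 0ℚ * G (true ∷ S) + 𝟙 (S ⊆? D) * G (false ∷ S)) (allSubsets m))
    ≡⟨ Σ-cong (λ S → trans (cong (_+ 𝟙 (S ⊆? D) * G (false ∷ S)) (ℚ.*-zeroˡ (G (true ∷ S))))
                           (ℚ.+-identityˡ _)) (allSubsets m) ⟩
  Σℚ (map (λ S → 𝟙 (S ⊆? D) * G (false ∷ S)) (allSubsets m))
    ≡⟨ Σ-⊆-embed D (G ∘ (false ∷_)) ⟩
  Σℚ (map (G ∘ embed (false ∷ D)) (allSubsets ∣ D ∣)) ∎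
  where open ≡-Reasoning

∣embed∣ : ∀ {m} (D : Subset m) T → ∣ embed D T ∣ ≡ ∣ T ∣
∣embed∣ []          []          = refl
∣embed∣ (true ∷ D)  (true ∷ T)  = cong suc (∣embed∣ D T)
∣embed∣ (true ∷ D)  (false ∷ T) = ∣embed∣ D T
∣embed∣ (false ∷ D) T           = ∣embed∣ D T

filter-∈?-map-suc : ∀ {m} b (D : Subset m) l →
                    filter (Subset._∈? (b ∷ D)) (map Fin.suc l) ≡ map Fin.suc (filter (Subset._∈? D) l)
filter-∈?-map-suc b D []      = refl
filter-∈?-map-suc b D (i ∷ l) with does (i Subset.∈? D)
... | true  = cong (Fin.suc i ∷_) (filter-∈?-map-suc b D l)
... | false = filter-∈?-map-suc b D l

elems-inside : ∀ {m} (D : Subset m) → elems (true ∷ D) ≡ zero ∷ map Fin.suc (elems D)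
elems-inside {m} D = cong (zero ∷_) (trans (cong (filter (Subset._∈? (true ∷ D))) (sym (map-tabulate (λ i → i) Fin.suc)))
                                           (filter-∈?-map-suc true D (allFin m)))

elems-outside : ∀ {m} (D : Subset m) → elems (false ∷ D) ≡ map Fin.suc (elems D)
elems-outside {m} D = trans (cong (filter (Subset._∈? (false ∷ D))) (sym (map-tabulate (λ i → i) Fin.suc)))
                            (filter-∈?-map-suc false D (allFin m))

elems-length : ∀ {m} (D : Subset m) → length (elems D) ≡ ∣ D ∣
elems-length []          = refl
elems-length (true ∷ D)  = trans (cong length (elems-inside D))
                                 (cong suc (trans (length-map Fin.suc (elems D)) (elems-length D)))
elems-length (false ∷ D) = trans (cong length (elems-outside D))
                                 (trans (length-map Fin.suc (elems D)) (elems-length D))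

module _ {m k} (D E : Subset m) (U : Subset k) (e : elems E ≡ select U (elems D)) where

  private
    map-suc-select : map Fin.suc (elems E) ≡ select U (map Fin.suc (elems D))
    map-suc-select = trans (cong (map Fin.suc) e) (sym (select-map Fin.suc U (elems D)))

  elems-∷-select-inside : ∀ b → elems (b ∷ E) ≡ select (b ∷ U) (elems (true ∷ D))
  elems-∷-select-inside true  = trans (elems-inside E)
    (trans (cong (zero ∷_) map-suc-select) (cong (select (true ∷ U)) (sym (elems-inside D))))
  elems-∷-select-inside false = trans (elems-outside E)
    (trans map-suc-select (cong (select (false ∷ U)) (sym (elems-inside D))))

  elems-∷-select-outside : elems (false ∷ E) ≡ select U (elems (false ∷ D))
  elems-∷-select-outside =
    trans (elems-outside E) (trans map-suc-select (cong (select U) (sym (elems-outside D))))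

elems-embed : ∀ {m} (D : Subset m) T → elems (embed D T) ≡ select T (elems D)
elems-embed []          []      = refl
elems-embed (true ∷ D)  (b ∷ T) = elems-∷-select-inside D _ T (elems-embed D T) b
elems-embed (false ∷ D) T       = elems-∷-select-outside D _ T (elems-embed D T)

elems-─-embed : ∀ {m} (D : Subset m) T → elems (D ─ embed D T) ≡ select (∁ T) (elems D)
elems-─-embed []          []          = refl
elems-─-embed (true ∷ D)  (true ∷ T)  = elems-∷-select-inside D _ (∁ T) (elems-─-embed D T) false
elems-─-embed (true ∷ D)  (false ∷ T) = elems-∷-select-inside D _ (∁ T) (elems-─-embed D T) true
elems-─-embed (false ∷ D) T           = elems-∷-select-outside D _ (∁ T) (elems-─-embed D T)

-- Counting masks by multiplicities

module Multiplicities {A : Set} (_≟_ : DecidableEquality A) where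

  open import Data.List.Membership.DecPropositional _≟_ using (_∈_; _∉_; _∈?_)
  open import Data.List.Relation.Unary.Unique.DecPropositional _≟_ using (unique?)
  open import Data.List.Relation.Binary.Permutation.Setoid (setoid A) using (↭-sym)
  open import Data.List.Relation.Binary.Permutation.Setoid.Properties (setoid A) using (↭-shift; Unique-resp-↭)

  Σ-pick : ∀ {l} → Unique l → (j : A) (g : A → ℚ) →
           Σℚ (map (λ a → 𝟙 (j ≟ a) * g a) l) ≡ 𝟙 (j ∈? l) * g j
  Σ-pick []               j g = sym (ℚ.*-zeroˡ (g j))
  Σ-pick {a ∷ l} (a∉l ∷ u) j g with j ≟ a
  ... | yes refl = trans (cong (1ℚ * g a +_) (trans (Σ-pick u a g) (cong (_* g a) (𝟙-no (All¬⇒¬Any a∉l) (a ∈? l)))))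
                         (trans (cong (1ℚ * g a +_) (ℚ.*-zeroˡ (g a))) (ℚ.+-identityʳ _))
  ... | no j≢a   = trans (cong₂ _+_ (ℚ.*-zeroˡ (g a)) (Σ-pick u j g)) (ℚ.+-identityˡ _)

  Unique-shift⁻ : ∀ xs {x ys} → Unique (xs ++ x ∷ ys) → x ∉ xs ++ ys × Unique (xs ++ ys)
  Unique-shift⁻ xs {ys = ys} u with Unique-resp-↭ (↭-shift xs ys) u
  ... | x≢ ∷ u′ = All¬⇒¬Any x≢ , u′

  Unique-shift⁺ : ∀ xs {x ys} → x ∉ xs ++ ys → Unique (xs ++ ys) → Unique (xs ++ x ∷ ys)
  Unique-shift⁺ xs {ys = ys} x∉ u = Unique-resp-↭ (↭-sym (↭-shift xs ys)) (¬Any⇒All¬ _ x∉ ∷ u)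

  count : A → List A → ℕ
  count j f = length (filter (j ≟_) f)

  _∖_ : List A → A → List A
  f ∖ j = filter (λ a → ¬? (j ≟ a)) f

  ∉-∖ : ∀ j f → j ∉ f ∖ j
  ∉-∖ j f j∈ = proj₂ (∈-filter⁻ (λ a → ¬? (j ≟ a)) {xs = f} j∈) refl

  count≡0⇒All≢ : ∀ {j} f → count j f ≡ 0 → All (j ≢_) f
  count≡0⇒All≢ {j} []      _ = []
  count≡0⇒All≢ {j} (a ∷ f) c≡0 with j ≟ a
  ... | no j≢a = j≢a ∷ count≡0⇒All≢ f c≡0

  Unique⇒count≤1 : ∀ {j f} → Unique f → count j f ℕ.≤ 1
  Unique⇒count≤1 {j} {[]}    []       = ℕ.z≤n
  Unique⇒count≤1 {j} {a ∷ f} (a∉ ∷ u) with j ≟ a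
  ... | yes refl rewrite filter-none (a ≟_) a∉ = ℕ.s≤s ℕ.z≤n
  ... | no _     = Unique⇒count≤1 u

  count≡1⇒Unique : ∀ {j} f → count j f ≡ 1 → Unique (f ∖ j) → Unique f
  count≡1⇒Unique {j} []      ()
  count≡1⇒Unique {j} (a ∷ f) c≡1 u with j ≟ a
  ... | yes refl = a∉f ∷ subst Unique (filter-all (λ b → ¬? (a ≟ b)) a∉f) u
    where a∉f = count≡0⇒All≢ f (ℕ.suc-injective c≡1)
  ... | no j≢a with u
  ...   | a∉ ∷ u′ = ¬Any⇒All¬ f (All¬⇒¬Any a∉ ∘ λ a∈f → ∈-filter⁺ (λ b → ¬? (j ≟ b)) a∈f j≢a)
                  ∷ count≡1⇒Unique f c≡1 u′

  maskTerm : (ℕ → ℚ) → A → List A → (f : List A) → Subset (length f) → ℚ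
  maskTerm w j V f T = w ∣ T ∣ * (𝟙 (all? (j ≟_) (select T f)) * 𝟙 (unique? (V ++ select (∁ T) f)))

  -- The prefix V (the values already left out of the mask) and the weight w, shifted by one for every
  -- selected entry, are what make this sum amenable to induction on f; the theorem uses maskSum signed! j [].
  maskSum : (ℕ → ℚ) → A → List A → List A → ℚ
  maskSum w j V f = Σℚ (map (maskTerm w j V f) (allSubsets (length f)))

  maskSum-[] : ∀ w j V → maskSum w j V [] ≡ w 0 * 𝟙 (unique? (V ++ []))
  maskSum-[] w j V = trans (ℚ.+-identityʳ _) (cong (w 0 *_) (ℚ.*-identityˡ _))

  maskSum-∷ : ∀ w j V a f → maskSum w j V (a ∷ f) ≡ 𝟙 (j ≟ a) * maskSum (w ∘ suc) j V f + maskSum w j (V ∷ʳ a) f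
  maskSum-∷ w j V a f = begin
    maskSum w j V (a ∷ f)
      ≡⟨ Σ-allSubsets-suc (maskTerm w j V (a ∷ f)) ⟩
    Σℚ (map (λ T → maskTerm w j V (a ∷ f) (true ∷ T) + maskTerm w j V (a ∷ f) (false ∷ T)) Ts)
      ≡⟨ Σ-+ _ _ Ts ⟩
    Σℚ (map (maskTerm w j V (a ∷ f) ∘ (true ∷_)) Ts) + Σℚ (map (maskTerm w j V (a ∷ f) ∘ (false ∷_)) Ts)
      ≡⟨ cong₂ _+_ (trans (Σ-cong selected Ts) (Σ-*ˡ (𝟙 (j ≟ a)) (maskTerm (w ∘ suc) j V f) Ts))
                   (Σ-cong rejected Ts) ⟩
    𝟙 (j ≟ a) * maskSum (w ∘ suc) j V f + maskSum w j (V ∷ʳ a) f ∎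
    where
    open ≡-Reasoning
    Ts = allSubsets (length f)
    identity : ∀ u e x y → u * ((e * x) * y) ≡ e * (u * (x * y))
    identity = solve-∀ ℚ-ring
    selected : ∀ T → maskTerm w j V (a ∷ f) (true ∷ T) ≡ 𝟙 (j ≟ a) * maskTerm (w ∘ suc) j V f T
    selected T = trans (cong (λ z → w (suc ∣ T ∣) * (z * unique-rest)) (𝟙-× (j ≟ a) (all? (j ≟_) (select T f))))
                       (identity (w (suc ∣ T ∣)) (𝟙 (j ≟ a)) (𝟙 (all? (j ≟_) (select T f))) unique-rest)
      where unique-rest = 𝟙 (unique? (V ++ select (∁ T) f))
    rejected : ∀ T → maskTerm w j V (a ∷ f) (false ∷ T) ≡ maskTerm w j (V ∷ʳ a) f T
    rejected T = cong (λ l → w ∣ T ∣ * (𝟙 (all? (j ≟_) (select T f)) * 𝟙 (unique? l)))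
                      (sym (∷ʳ-++ V a (select (∁ T) f)))

  maskSum-∷-≡ : ∀ w a V f → maskSum w a V (a ∷ f) ≡ maskSum (w ∘ suc) a V f + maskSum w a (V ∷ʳ a) f
  maskSum-∷-≡ w a V f = trans (maskSum-∷ w a V a f) (cong (_+ maskSum w a (V ∷ʳ a) f)
    (trans (cong (_* maskSum (w ∘ suc) a V f) (𝟙-yes refl (a ≟ a))) (ℚ.*-identityˡ (maskSum (w ∘ suc) a V f))))

  maskSum-∷-≢ : ∀ {j a} → j ≢ a → ∀ w V f → maskSum w j V (a ∷ f) ≡ maskSum w j (V ∷ʳ a) f
  maskSum-∷-≢ {j} {a} j≢a w V f = trans (maskSum-∷ w j V a f)
    (trans (cong (_+ maskSum w j (V ∷ʳ a) f)
                 (trans (cong (_* maskSum (w ∘ suc) j V f) (𝟙-no j≢a (j ≟ a))) (ℚ.*-zeroˡ (maskSum (w ∘ suc) j V f))))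
           (ℚ.+-identityˡ (maskSum w j (V ∷ʳ a) f)))

  unique?-∷ʳ-++ : ∀ V (a : A) l → 𝟙 (unique? (V ∷ʳ a ++ l)) ≡ 𝟙 (unique? (V ++ a ∷ l))
  unique?-∷ʳ-++ V a l = cong (𝟙 ∘ unique?) (∷ʳ-++ V a l)

  maskSum-∈ : ∀ {j V} → j ∈ V → ∀ w f → maskSum w j V f ≡ w (count j f) * 𝟙 (unique? (V ++ f ∖ j))
  maskSum-∈ {j} {V} j∈V w []      = maskSum-[] w j V
  maskSum-∈ {j} {V} j∈V w (a ∷ f) with j ≟ a
  ... | no j≢a = trans (maskSum-∷-≢ j≢a w V f)
    (trans (maskSum-∈ (∈-++⁺ˡ j∈V) w f) (cong (w (count j f) *_) (unique?-∷ʳ-++ V a (f ∖ j))))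
  ... | yes refl = begin
    maskSum w j V (j ∷ f)
      ≡⟨ maskSum-∷-≡ w j V f ⟩
    maskSum (w ∘ suc) j V f + maskSum w j (V ∷ʳ j) f
      ≡⟨ cong₂ _+_ (maskSum-∈ j∈V (w ∘ suc) f) (maskSum-∈ (∈-++⁺ˡ j∈V) w f) ⟩
    selected + w (count j f) * 𝟙 (unique? (V ∷ʳ j ++ f ∖ j))
      ≡⟨ cong (λ z → selected + w (count j f) * z) (𝟙-no duplicate (unique? (V ∷ʳ j ++ f ∖ j))) ⟩
    selected + w (count j f) * 0ℚ
      ≡⟨ trans (cong (selected +_) (ℚ.*-zeroʳ (w (count j f)))) (ℚ.+-identityʳ selected) ⟩
    selected ∎
    where
    open ≡-Reasoning
    selected = w (suc (count j f)) * 𝟙 (unique? (V ++ f ∖ j))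
    duplicate : ¬ Unique (V ∷ʳ j ++ f ∖ j)
    duplicate u = proj₁ (Unique-shift⁻ V (subst Unique (∷ʳ-++ V j (f ∖ j)) u)) (∈-++⁺ˡ j∈V)

  maskSum-∉ : ∀ {j V} → j ∉ V → ∀ w f → maskSum w j V f ≡ Φ w (count j f) * 𝟙 (unique? (V ++ f ∖ j))
  maskSum-∉ {j} {V} j∉V w []      = maskSum-[] w j V
  maskSum-∉ {j} {V} j∉V w (a ∷ f) with j ≟ a
  ... | no j≢a = trans (maskSum-∷-≢ j≢a w V f)
    (trans (maskSum-∉ j∉V∷ʳa w f) (cong (Φ w (count j f) *_) (unique?-∷ʳ-++ V a (f ∖ j))))
    where
    j∉V∷ʳa : j ∉ V ∷ʳ a
    j∉V∷ʳa j∈ with ∈-++⁻ V j∈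
    ... | inj₁ j∈V        = j∉V j∈V
    ... | inj₂ (here j≡a) = j≢a j≡a
  ... | yes refl = begin
    maskSum w j V (j ∷ f)
      ≡⟨ maskSum-∷-≡ w j V f ⟩
    maskSum (w ∘ suc) j V f + maskSum w j (V ∷ʳ j) f
      ≡⟨ cong₂ _+_ (maskSum-∉ j∉V (w ∘ suc) f) (maskSum-∈ (∈-++⁺ʳ V (here refl)) w f) ⟩
    Φ (w ∘ suc) c * u + w c * 𝟙 (unique? (V ∷ʳ j ++ f ∖ j))
      ≡⟨ cong (λ z → Φ (w ∘ suc) c * u + w c * z)
              (𝟙-⇔ shrink grow (unique? (V ∷ʳ j ++ f ∖ j)) (unique? (V ++ f ∖ j))) ⟩
    Φ (w ∘ suc) c * u + w c * u
      ≡⟨ ℚ.*-distribʳ-+ u (Φ (w ∘ suc) c) (w c) ⟨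
    (Φ (w ∘ suc) c + w c) * u
      ≡⟨ cong (_* u) (Φ-suc w c) ⟩
    Φ w (suc c) * u ∎
    where
    open ≡-Reasoning
    c = count j f
    u = 𝟙 (unique? (V ++ f ∖ j))
    j∉V++f∖j : j ∉ V ++ f ∖ j
    j∉V++f∖j j∈ with ∈-++⁻ V j∈
    ... | inj₁ j∈V   = j∉V j∈V
    ... | inj₂ j∈f∖j = ∉-∖ j f j∈f∖j
    shrink : Unique (V ∷ʳ j ++ f ∖ j) → Unique (V ++ f ∖ j)
    shrink = proj₂ ∘ Unique-shift⁻ V ∘ subst Unique (∷ʳ-++ V j (f ∖ j))
    grow : Unique (V ++ f ∖ j) → Unique (V ∷ʳ j ++ f ∖ j)
    grow = subst Unique (sym (∷ʳ-++ V j (f ∖ j))) ∘ Unique-shift⁺ V j∉V++f∖j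

  Σ-𝟙-≟ : ∀ {J} → Unique J → ∀ {a} → a ∈ J → Σℚ (map (λ j → 𝟙 (j ≟ a)) J) ≡ 1ℚ
  Σ-𝟙-≟ {J} uJ {a} a∈J = begin
    Σℚ (map (λ j → 𝟙 (j ≟ a)) J)
      ≡⟨ Σ-cong (λ j → trans (𝟙-⇔ sym sym (j ≟ a) (a ≟ j)) (sym (ℚ.*-identityʳ _))) J ⟩
    Σℚ (map (λ j → 𝟙 (a ≟ j) * 1ℚ) J)
      ≡⟨ Σ-pick uJ a (λ _ → 1ℚ) ⟩
    𝟙 (a ∈? J) * 1ℚ
      ≡⟨ trans (ℚ.*-identityʳ _) (𝟙-yes a∈J (a ∈? J)) ⟩
    1ℚ ∎
    where open ≡-Reasoning

  ι-count-∷ : ∀ j a f → ι (count j (a ∷ f)) ≡ 𝟙 (j ≟ a) + ι (count j f)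
  ι-count-∷ j a f with j ≟ a
  ... | yes _ = ι-suc (count j f)
  ... | no _  = sym (ℚ.+-identityˡ _)

  Σ-count : ∀ {J} → Unique J → ∀ {f} → All (_∈ J) f → Σℚ (map (λ j → ι (count j f)) J) ≡ ι (length f)
  Σ-count {J} uJ {[]}    []          = Σ-≡0 (λ _ → refl) J
  Σ-count {J} uJ {a ∷ f} (a∈J ∷ f⊆J) = begin
    Σℚ (map (λ j → ι (count j (a ∷ f))) J)
      ≡⟨ Σ-cong (λ j → ι-count-∷ j a f) J ⟩
    Σℚ (map (λ j → 𝟙 (j ≟ a) + ι (count j f)) J)
      ≡⟨ Σ-+ _ _ J ⟩
    Σℚ (map (λ j → 𝟙 (j ≟ a)) J) + Σℚ (map (λ j → ι (count j f)) J)
      ≡⟨ cong₂ _+_ (Σ-𝟙-≟ uJ a∈J) (Σ-count uJ f⊆J) ⟩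
    1ℚ + ι (length f)
      ≡⟨ ι-suc (length f) ⟨
    ι (length (a ∷ f)) ∎
    where open ≡-Reasoning

  Σ-Φ-signed! : ∀ {J} → Unique J → ∀ {f} → All (_∈ J) f →
                Σℚ (map (λ j → Φ signed! (count j f) * 𝟙 (unique? (f ∖ j))) J) ≡ ι (length f) * 𝟙 (unique? f)
  Σ-Φ-signed! {J} uJ {f} f⊆J with unique? f
  ... | yes u = trans (Σ-cong pointwise J) (trans (Σ-count uJ f⊆J) (sym (ℚ.*-identityʳ (ι (length f)))))
    where
    pointwise : ∀ j → Φ signed! (count j f) * 𝟙 (unique? (f ∖ j)) ≡ ι (count j f)
    pointwise j = trans (cong₂ _*_ (Φ-signed!-≤1 (Unique⇒count≤1 u)) (𝟙-yes (filter⁺ _ u) (unique? (f ∖ j))))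
                        (ℚ.*-identityʳ (ι (count j f)))
  ... | no ¬u = trans (Σ-≡0 pointwise J) (sym (ℚ.*-zeroʳ (ι (length f))))
    where
    pointwise : ∀ j → Φ signed! (count j f) * 𝟙 (unique? (f ∖ j)) ≡ 0ℚ
    pointwise j with count j f in c≡
    ... | 0           = ℚ.*-zeroˡ (𝟙 (unique? (f ∖ j)))
    ... | 1           = trans (cong (Φ signed! 1 *_) (𝟙-no (¬u ∘ count≡1⇒Unique f c≡) (unique? (f ∖ j))))
                              (ℚ.*-zeroʳ (Φ signed! 1))
    ... | suc (suc c) = trans (cong (_* 𝟙 (unique? (f ∖ j))) (Φ-signed!-2+ c)) (ℚ.*-zeroˡ (𝟙 (unique? (f ∖ j))))

  Σ-maskSum-signed! : ∀ {J} → Unique J → ∀ {f} → All (_∈ J) f →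
                      Σℚ (map (λ j → maskSum signed! j [] f) J) ≡ ι (length f) * 𝟙 (unique? f)
  Σ-maskSum-signed! {J} uJ {f} f⊆J =
    trans (Σ-cong (λ j → maskSum-∉ {V = []} (λ ()) signed! f) J) (Σ-Φ-signed! uJ f⊆J)

-- Expanding over all maps into [n]

module _ {n : ℕ} where

  open Multiplicities (_≟_ {n})
  open import Data.List.Relation.Unary.Unique.DecPropositional (_≟_ {n}) using (unique?)
  open import Data.List.Membership.DecPropositional (_≟_ {n}) using (_∈?_)

  Σ-pick-allFin : ∀ j (g : Fin n → ℚ) → Σℚ (map (λ c → 𝟙 (j ≟ c) * g c) (allFin n)) ≡ g j
  Σ-pick-allFin j g = trans (Σ-pick (allFin⁺ n) j g)
                            (trans (cong (_* g j) (𝟙-yes (∈-allFin j) (j ∈? allFin n))) (ℚ.*-identityˡ (g j)))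

  Σ-tuples-suc : ∀ k (g : List (Fin n) → ℚ) →
                 Σℚ (map g (tuples n (suc k))) ≡ Σℚ (map (λ c → Σℚ (map (g ∘ (c ∷_)) (tuples n k))) (allFin n))
  Σ-tuples-suc k g = trans (Σ-concatMap g (λ c → map (c ∷_) (tuples n k)) (allFin n))
                           (Σ-cong (λ c → cong Σℚ (sym (map-∘ (tuples n k)))) (allFin n))

  Σ-tuples-cong : ∀ k {g h : List (Fin n) → ℚ} → (∀ f → length f ≡ k → g f ≡ h f) →
                  Σℚ (map g (tuples n k)) ≡ Σℚ (map h (tuples n k))
  Σ-tuples-cong zero            g≗h = cong (_+ 0ℚ) (g≗h [] refl)
  Σ-tuples-cong (suc k) {g} {h} g≗h = trans (Σ-tuples-suc k g)
    (trans (Σ-cong (λ c → Σ-tuples-cong k (λ f e → g≗h (c ∷ f) (cong suc e))) (allFin n)) (sym (Σ-tuples-suc k h)))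

  module _ {I : Set} (x : I → Fin n → ℚ) where

    -- B x D and X x S j unfold to per x (elems D) and colProd x (elems S) j.
    colProd : List I → Fin n → ℚ
    colProd is j = Πℚ (map (λ i → x i j) is)

    per : List I → ℚ
    per is = Σℚ (map (λ γ → Πℚ (zipWith x is γ)) (filter unique? (tuples n (length is))))

    weightedPer : (List (Fin n) → ℚ) → List I → ℚ
    weightedPer h is = Σℚ (map (λ γ → h γ * Πℚ (zipWith x is γ)) (tuples n (length is)))

    per-as-weightedPer : ∀ is → per is ≡ weightedPer (𝟙 ∘ unique?) is
    per-as-weightedPer is = Σ-filter unique? (λ γ → Πℚ (zipWith x is γ)) (tuples n (length is))

    weightedPer-∷ : ∀ h i is →
                    weightedPer h (i ∷ is) ≡ Σℚ (map (λ c → x i c * weightedPer (h ∘ (c ∷_)) is) (allFin n))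
    weightedPer-∷ h i is = trans (Σ-tuples-suc (length is) _) (Σ-cong (λ c →
      trans (Σ-cong (λ γ → identity (h (c ∷ γ)) (x i c) (Πℚ (zipWith x is γ))) (tuples n (length is)))
            (Σ-*ˡ (x i c) _ (tuples n (length is)))) (allFin n))
      where
      identity : ∀ u v w → u * (v * w) ≡ v * (u * w)
      identity = solve-∀ ℚ-ring

    splitTerm : ∀ {k} → List I → Subset k → Fin n → (List (Fin n) → ℚ) → List (Fin n) → ℚ
    splitTerm is T j h f = 𝟙 (all? (j ≟_) (select T f)) * h (select (∁ T) f) * Πℚ (zipWith x is f)

    colProd-*-weightedPer : ∀ is (T : Subset (length is)) j h →
      colProd (select T is) j * weightedPer h (select (∁ T) is) ≡ Σℚ (map (splitTerm is T j h) (tuples n (length is)))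
    colProd-*-weightedPer []       []          j h = identity (h [])
      where
      identity : ∀ u → 1ℚ * (u * 1ℚ + 0ℚ) ≡ 1ℚ * u * 1ℚ + 0ℚ
      identity = solve-∀ ℚ-ring
    colProd-*-weightedPer (i ∷ is) (true ∷ T)  j h = begin
      (x i j * colProd (select T is) j) * weightedPer h (select (∁ T) is)
        ≡⟨ ℚ.*-assoc (x i j) _ _ ⟩
      x i j * (colProd (select T is) j * weightedPer h (select (∁ T) is))
        ≡⟨ cong (x i j *_) (colProd-*-weightedPer is T j h) ⟩
      x i j * Σℚ (map (splitTerm is T j h) Fs)
        ≡⟨ Σ-pick-allFin j (λ c → x i c * Σℚ (map (splitTerm is T j h) Fs)) ⟨
      Σℚ (map (λ c → 𝟙 (j ≟ c) * (x i c * Σℚ (map (splitTerm is T j h) Fs))) (allFin n))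
        ≡⟨ Σ-cong (λ c → trans (sym (ℚ.*-assoc (𝟙 (j ≟ c)) (x i c) _))
                               (sym (Σ-*ˡ (𝟙 (j ≟ c) * x i c) (splitTerm is T j h) Fs))) (allFin n) ⟩
      Σℚ (map (λ c → Σℚ (map (λ f → (𝟙 (j ≟ c) * x i c) * splitTerm is T j h f) Fs)) (allFin n))
        ≡⟨ Σ-cong (λ c → Σ-cong (selected c) Fs) (allFin n) ⟩
      Σℚ (map (λ c → Σℚ (map (splitTerm (i ∷ is) (true ∷ T) j h ∘ (c ∷_)) Fs)) (allFin n))
        ≡⟨ Σ-tuples-suc (length is) (splitTerm (i ∷ is) (true ∷ T) j h) ⟨
      Σℚ (map (splitTerm (i ∷ is) (true ∷ T) j h) (tuples n (suc (length is)))) ∎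
      where
      open ≡-Reasoning
      Fs = tuples n (length is)
      identity : ∀ e a u v p → (e * v) * ((a * u) * p) ≡ (e * a) * u * (v * p)
      identity = solve-∀ ℚ-ring
      selected : ∀ c f → (𝟙 (j ≟ c) * x i c) * splitTerm is T j h f ≡ splitTerm (i ∷ is) (true ∷ T) j h (c ∷ f)
      selected c f =
        trans (identity (𝟙 (j ≟ c)) (𝟙 (all? (j ≟_) (select T f))) (h (select (∁ T) f)) (x i c) (Πℚ (zipWith x is f)))
              (cong (λ z → z * h (select (∁ T) f) * (x i c * Πℚ (zipWith x is f)))
                    (sym (𝟙-× (j ≟ c) (all? (j ≟_) (select T f)))))
    colProd-*-weightedPer (i ∷ is) (false ∷ T) j h = begin
      colProd (select T is) j * weightedPer h (i ∷ select (∁ T) is)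
        ≡⟨ cong (colProd (select T is) j *_) (weightedPer-∷ h i (select (∁ T) is)) ⟩
      colProd (select T is) j * Σℚ (map (λ c → x i c * weightedPer (h ∘ (c ∷_)) (select (∁ T) is)) (allFin n))
        ≡⟨ Σ-*ˡ (colProd (select T is) j) _ (allFin n) ⟨
      Σℚ (map (λ c → colProd (select T is) j * (x i c * weightedPer (h ∘ (c ∷_)) (select (∁ T) is))) (allFin n))
        ≡⟨ Σ-cong (λ c → trans (identity (colProd (select T is) j) (x i c) _)
                               (cong (x i c *_) (colProd-*-weightedPer is T j (h ∘ (c ∷_))))) (allFin n) ⟩
      Σℚ (map (λ c → x i c * Σℚ (map (splitTerm is T j (h ∘ (c ∷_))) Fs)) (allFin n))
        ≡⟨ Σ-cong (λ c → trans (sym (Σ-*ˡ (x i c) (splitTerm is T j (h ∘ (c ∷_))) Fs))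
                               (Σ-cong (rejected c) Fs)) (allFin n) ⟩
      Σℚ (map (λ c → Σℚ (map (splitTerm (i ∷ is) (false ∷ T) j h ∘ (c ∷_)) Fs)) (allFin n))
        ≡⟨ Σ-tuples-suc (length is) (splitTerm (i ∷ is) (false ∷ T) j h) ⟨
      Σℚ (map (splitTerm (i ∷ is) (false ∷ T) j h) (tuples n (suc (length is)))) ∎
      where
      open ≡-Reasoning
      Fs = tuples n (length is)
      identity : ∀ u v w → u * (v * w) ≡ v * (u * w)
      identity = solve-∀ ℚ-ring
      identity′ : ∀ v e u p → v * (e * u * p) ≡ e * u * (v * p)
      identity′ = solve-∀ ℚ-ring
      rejected : ∀ c f → x i c * splitTerm is T j (h ∘ (c ∷_)) f ≡ splitTerm (i ∷ is) (false ∷ T) j h (c ∷ f)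
      rejected c f = identity′ (x i c) (𝟙 (all? (j ≟_) (select T f))) (h (c ∷ select (∁ T) f)) (Πℚ (zipWith x is f))

    Σ-signed!-splitTerm : ∀ is f {k} → length f ≡ k →
      Σℚ (map (λ j → Σℚ (map (λ T → signed! ∣ T ∣ * splitTerm is T j (𝟙 ∘ unique?) f) (allSubsets k))) (allFin n))
        ≡ ι k * (𝟙 (unique? f) * Πℚ (zipWith x is f))
    Σ-signed!-splitTerm is f refl = begin
      Σℚ (map (λ j → Σℚ (map (λ T → signed! ∣ T ∣ * splitTerm is T j (𝟙 ∘ unique?) f) Ts)) (allFin n))
        ≡⟨ Σ-cong (λ j → trans (Σ-cong (rearrange j) Ts) (Σ-*ˡ p (maskTerm signed! j [] f) Ts)) (allFin n) ⟩
      Σℚ (map (λ j → p * maskSum signed! j [] f) (allFin n))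
        ≡⟨ Σ-*ˡ p (λ j → maskSum signed! j [] f) (allFin n) ⟩
      p * Σℚ (map (λ j → maskSum signed! j [] f) (allFin n))
        ≡⟨ cong (p *_) (Σ-maskSum-signed! (allFin⁺ n) (universal ∈-allFin f)) ⟩
      p * (ι (length f) * 𝟙 (unique? f))
        ≡⟨ identity′ p (ι (length f)) (𝟙 (unique? f)) ⟩
      ι (length f) * (𝟙 (unique? f) * p) ∎
      where
      open ≡-Reasoning
      p  = Πℚ (zipWith x is f)
      Ts = allSubsets (length f)
      identity : ∀ s a u p → s * ((a * u) * p) ≡ p * (s * (a * u))
      identity = solve-∀ ℚ-ring
      identity′ : ∀ p i u → p * (i * u) ≡ i * (u * p)
      identity′ = solve-∀ ℚ-ring
      rearrange : ∀ j T → signed! ∣ T ∣ * splitTerm is T j (𝟙 ∘ unique?) f ≡ p * maskTerm signed! j [] f T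
      rearrange j T = identity (signed! ∣ T ∣) (𝟙 (all? (j ≟_) (select T f))) (𝟙 (unique? (select (∁ T) f))) p

    signedSplitSum : List I → (k : ℕ) → ℚ
    signedSplitSum is k =
      Σℚ (map (λ T → signed! ∣ T ∣ * (Σℚ (map (colProd (select T is)) (allFin n)) * per (select (∁ T) is)))
              (allSubsets k))

    per-expansion : ∀ is {k} → length is ≡ k → ι k * per is ≡ signedSplitSum is k
    per-expansion is refl = sym (begin
      signedSplitSum is (length is)
        ≡⟨ Σ-cong (λ T → trans (cong (signed! ∣ T ∣ *_) (split T)) (sym (Σ-*ˡ (signed! ∣ T ∣) _ (allFin n)))) Ts ⟩
      Σℚ (map (λ T → Σℚ (map (λ j → signed! ∣ T ∣ * Σℚ (map (splitTerm is T j U) Fs)) (allFin n))) Ts)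
        ≡⟨ Σ-cong (λ T → Σ-cong (λ j → sym (Σ-*ˡ (signed! ∣ T ∣) (splitTerm is T j U) Fs)) (allFin n)) Ts ⟩
      Σℚ (map (λ T → Σℚ (map (λ j → Σℚ (map (λ f → signed! ∣ T ∣ * splitTerm is T j U f) Fs)) (allFin n))) Ts)
        ≡⟨ Σ-reverse₃ (λ T j f → signed! ∣ T ∣ * splitTerm is T j U f) Ts (allFin n) Fs ⟩
      Σℚ (map (λ f → Σℚ (map (λ j → Σℚ (map (λ T → signed! ∣ T ∣ * splitTerm is T j U f) Ts)) (allFin n))) Fs)
        ≡⟨ Σ-tuples-cong (length is) (λ f → Σ-signed!-splitTerm is f) ⟩
      Σℚ (map (λ f → ι (length is) * (U f * Πℚ (zipWith x is f))) Fs)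
        ≡⟨ Σ-*ˡ (ι (length is)) _ Fs ⟩
      ι (length is) * weightedPer U is
        ≡⟨ cong (ι (length is) *_) (per-as-weightedPer is) ⟨
      ι (length is) * per is ∎)
      where
      open ≡-Reasoning
      U  = 𝟙 ∘ unique?
      Ts = allSubsets (length is)
      Fs = tuples n (length is)
      split : ∀ T → Σℚ (map (colProd (select T is)) (allFin n)) * per (select (∁ T) is)
                      ≡ Σℚ (map (λ j → Σℚ (map (splitTerm is T j U) Fs)) (allFin n))
      split T = trans (cong (Σℚ (map (colProd (select T is)) (allFin n)) *_) (per-as-weightedPer (select (∁ T) is)))
        (trans (sym (Σ-*ʳ (weightedPer U (select (∁ T) is)) (colProd (select T is)) (allFin n)))
               (Σ-cong (λ j → colProd-*-weightedPer is T j U) (allFin n)))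

-- The coefficients of the identity

Σ-subsetsOfSize : ∀ {m} (D : Subset m) k (G : Subset m → ℚ) →
  Σℚ (map G (subsetsOfSize D k)) ≡ Σℚ (map (λ T → 𝟙 (∣ T ∣ ℕ.≟ k) * G (embed D T)) (allSubsets ∣ D ∣))
Σ-subsetsOfSize {m} D k G = begin
  Σℚ (map G (subsetsOfSize D k))
    ≡⟨ Σ-filter (λ S → (S ⊆? D) ×-dec (∣ S ∣ ℕ.≟ k)) G (allSubsets m) ⟩
  Σℚ (map (λ S → 𝟙 ((S ⊆? D) ×-dec (∣ S ∣ ℕ.≟ k)) * G S) (allSubsets m))
    ≡⟨ Σ-cong (λ S → trans (cong (_* G S) (𝟙-× (S ⊆? D) (∣ S ∣ ℕ.≟ k)))
                           (ℚ.*-assoc (𝟙 (S ⊆? D)) (𝟙 (∣ S ∣ ℕ.≟ k)) (G S))) (allSubsets m) ⟩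
  Σℚ (map (λ S → 𝟙 (S ⊆? D) * (𝟙 (∣ S ∣ ℕ.≟ k) * G S)) (allSubsets m))
    ≡⟨ Σ-⊆-embed D (λ S → 𝟙 (∣ S ∣ ℕ.≟ k) * G S) ⟩
  Σℚ (map (λ T → 𝟙 (∣ embed D T ∣ ℕ.≟ k) * G (embed D T)) (allSubsets ∣ D ∣))
    ≡⟨ Σ-cong (λ T → cong (λ s → 𝟙 (s ℕ.≟ k) * G (embed D T)) (∣embed∣ D T)) (allSubsets ∣ D ∣) ⟩
  Σℚ (map (λ T → 𝟙 (∣ T ∣ ℕ.≟ k) * G (embed D T)) (allSubsets ∣ D ∣)) ∎
  where open ≡-Reasoning

coefficient : ℕ → ℕ → ℚ
coefficient d k = powℚ (- 1ℚ) (k ∸ 1) * fracℚ (k !) d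

Σ-coefficient : ∀ {d} → 1 ℕ.≤ d → ∀ {s} → s ℕ.≤ d →
  Σℚ (map (λ k → 𝟙 (s ℕ.≟ k) * coefficient d k) (map suc (upTo d))) ≡ signed! s * fracℚ 1 d
Σ-coefficient {d} 1≤d {s} s≤d = begin
  Σℚ (map (λ k → 𝟙 (s ℕ.≟ k) * coefficient d k) (map suc (upTo d)))
    ≡⟨ cong Σℚ (sym (map-∘ (upTo d))) ⟩
  Σℚ (map (λ k → 𝟙 (s ℕ.≟ suc k) * coefficient d (suc k)) (upTo d))
    ≡⟨ Σ-cong (λ k → cong (𝟙 (s ℕ.≟ suc k) *_) (signed-coefficient k)) (upTo d) ⟩
  Σℚ (map (λ k → 𝟙 (s ℕ.≟ suc k) * (signed! (suc k) * fracℚ 1 d)) (upTo d))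
    ≡⟨ cong Σℚ (map-∘ (upTo d)) ⟩
  Σℚ (map (λ k → 𝟙 (s ℕ.≟ k) * (signed! k * fracℚ 1 d)) (map suc (upTo d)))
    ≡⟨ Σ-pick (map⁺ ℕ.suc-injective (upTo⁺ d)) s (λ k → signed! k * fracℚ 1 d) ⟩
  𝟙 (s ∈? map suc (upTo d)) * (signed! s * fracℚ 1 d)
    ≡⟨ in-range s s≤d ⟩
  signed! s * fracℚ 1 d ∎
  where
  open ≡-Reasoning
  open Multiplicities ℕ._≟_ using (Σ-pick)
  open import Data.List.Membership.DecPropositional ℕ._≟_ using (_∈?_)
  signed-coefficient : ∀ k → coefficient d (suc k) ≡ signed! (suc k) * fracℚ 1 d
  signed-coefficient k = trans (cong (powℚ (- 1ℚ) k *_) (fracℚ-as-* (suc k !) 1≤d))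
                               (sym (ℚ.*-assoc (powℚ (- 1ℚ) k) (ι (suc k !)) (fracℚ 1 d)))
  in-range : ∀ s → s ℕ.≤ d → 𝟙 (s ∈? map suc (upTo d)) * (signed! s * fracℚ 1 d) ≡ signed! s * fracℚ 1 d
  in-range zero    _   = trans (cong (𝟙 (0 ∈? map suc (upTo d)) *_) (ℚ.*-zeroˡ (fracℚ 1 d)))
                               (trans (ℚ.*-zeroʳ (𝟙 (0 ∈? map suc (upTo d)))) (sym (ℚ.*-zeroˡ (fracℚ 1 d))))
  in-range (suc s) s<d = trans (cong (_* (signed! (suc s) * fracℚ 1 d))
                                     (𝟙-yes (∈-map⁺ suc (∈-upTo⁺ s<d)) (suc s ∈? map suc (upTo d))))
                               (ℚ.*-identityˡ (signed! (suc s) * fracℚ 1 d))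

RHS-as-signedSplitSum : ∀ {n} (x : Vars n) D → 1 ℕ.≤ ∣ D ∣ →
                        RHS x D ≡ fracℚ 1 ∣ D ∣ * signedSplitSum x (elems D) ∣ D ∣
RHS-as-signedSplitSum {n} x D 1≤∣D∣ = begin
  RHS x D
    ≡⟨ Σ-cong (λ k → cong (coefficient ∣ D ∣ k *_) (Σ-subsetsOfSize D k rhsTerm)) ks ⟩
  Σℚ (map (λ k → coefficient ∣ D ∣ k * Σℚ (map (λ T → 𝟙 (∣ T ∣ ℕ.≟ k) * rhsTerm (embed D T)) Ms)) ks)
    ≡⟨ Σ-cong (λ k → sym (Σ-*ˡ (coefficient ∣ D ∣ k) _ Ms)) ks ⟩
  Σℚ (map (λ k → Σℚ (map (λ T → coefficient ∣ D ∣ k * (𝟙 (∣ T ∣ ℕ.≟ k) * rhsTerm (embed D T))) Ms)) ks)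
    ≡⟨ Σ-swap (λ k T → coefficient ∣ D ∣ k * (𝟙 (∣ T ∣ ℕ.≟ k) * rhsTerm (embed D T))) ks Ms ⟩
  Σℚ (map (λ T → Σℚ (map (λ k → coefficient ∣ D ∣ k * (𝟙 (∣ T ∣ ℕ.≟ k) * rhsTerm (embed D T))) ks)) Ms)
    ≡⟨ Σ-cong (λ T → trans (Σ-cong (λ k → identity (coefficient ∣ D ∣ k) (𝟙 (∣ T ∣ ℕ.≟ k)) (rhsTerm (embed D T))) ks)
                           (Σ-*ʳ (rhsTerm (embed D T)) (λ k → 𝟙 (∣ T ∣ ℕ.≟ k) * coefficient ∣ D ∣ k) ks))
              Ms ⟩
  Σℚ (map (λ T → Σℚ (map (λ k → 𝟙 (∣ T ∣ ℕ.≟ k) * coefficient ∣ D ∣ k) ks) * rhsTerm (embed D T)) Ms)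
    ≡⟨ Σ-cong (λ T → cong₂ _*_ (Σ-coefficient 1≤∣D∣ (∣p∣≤n T)) (rhsTerm-embed T)) Ms ⟩
  Σℚ (map (λ T → (signed! ∣ T ∣ * φ) * splitProduct T) Ms)
    ≡⟨ Σ-cong (λ T → identity′ (signed! ∣ T ∣) φ (splitProduct T)) Ms ⟩
  Σℚ (map (λ T → φ * (signed! ∣ T ∣ * splitProduct T)) Ms)
    ≡⟨ Σ-*ˡ φ (λ T → signed! ∣ T ∣ * splitProduct T) Ms ⟩
  φ * signedSplitSum x (elems D) ∣ D ∣ ∎
  where
  open ≡-Reasoning
  ks = map suc (upTo ∣ D ∣)
  Ms = allSubsets ∣ D ∣
  φ  = fracℚ 1 ∣ D ∣
  rhsTerm : Subset (suc n) → ℚ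
  rhsTerm S = Σℚ (map (X x S) (allFin n)) * B x (D ─ S)
  splitProduct : Subset ∣ D ∣ → ℚ
  splitProduct T = Σℚ (map (colProd x (select T (elems D))) (allFin n)) * per x (select (∁ T) (elems D))
  rhsTerm-embed : ∀ T → rhsTerm (embed D T) ≡ splitProduct T
  rhsTerm-embed T = cong₂ (λ S E → Σℚ (map (colProd x S) (allFin n)) * per x E) (elems-embed D T) (elems-─-embed D T)
  identity : ∀ c e t → c * (e * t) ≡ (e * c) * t
  identity = solve-∀ ℚ-ring
  identity′ : ∀ s φ y → (s * φ) * y ≡ φ * (s * y)
  identity′ = solve-∀ ℚ-ring

lemmaC10 : (n : ℕ) → 1 ℕ.≤ n → (x : Vars n) → (D : Subset (suc n)) →
           2 ℕ.≤ ∣ D ∣ → B x D ≡ RHS x D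
lemmaC10 n _ x D 2≤∣D∣ = sym (begin
  RHS x D                                   ≡⟨ RHS-as-signedSplitSum x D 1≤∣D∣ ⟩
  φ * signedSplitSum x (elems D) ∣ D ∣      ≡⟨ cong (φ *_) (per-expansion x (elems D) (elems-length D)) ⟨
  φ * (ι ∣ D ∣ * B x D)                     ≡⟨ ℚ.*-assoc φ (ι ∣ D ∣) (B x D) ⟨
  (φ * ι ∣ D ∣) * B x D                     ≡⟨ cong (_* B x D) (fracℚ-1-*-ι 1≤∣D∣) ⟩
  1ℚ * B x D                                ≡⟨ ℚ.*-identityˡ (B x D) ⟩
  B x D                                     ∎)
  where
  open ≡-Reasoning
  1≤∣D∣ = ℕ.<⇒≤ 2≤∣D∣
  φ     = fracℚ 1 ∣ D ∣
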